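{- Let $d\geq 1$ be an integer, let $\mathcal{R}$ be the collection of all $d$-regular graphs, let $n$ be a positive integer and let $H$ be any graph. Then $$\chi_{\mathcal{R}}(H\oplus K_n)\geq \frac{\chi_{\mathcal{R}}(H)+n}{d}.$$
   Context: All graphs are finite, simple and undirected. For a collection $\mathcal{R}$ of graphs, $H$ is $\mathcal{R}$-free if it has no subgraph isomorphic to any member of $\mathcal{R}$. A $k$-$\mathcal{R}$-free coloring of $H$ is a map $c:V(H)\to\{1,\dots,k\}$ each of whose color classes induces an $\mathcal{R}$-free subgraph; $\chi_{\mathcal{R}}(H)$ is the least such $k$. $K_n$ is the complete graph on $n$ vertices and $H\oplus K_n$ is the join (disjoint union of $H$ and $K_n$ plus all edges between $V(H)$ and $V(K_n)$). -}

module Defs where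

open import Data.Nat using (ℕ; zero; suc; _+_; _*_; _≤_)
open import Data.Bool using (Bool; true; false; if_then_else_; not)
open import Data.Fin using (Fin; splitAt; _≟_)
open import Data.Sum using (_⊎_; inj₁; inj₂)
open import Data.Product using (Σ; _×_; _,_; ∃)
open import Data.List using (List; map; allFin)
open import Data.Nat.ListAction using (sum)
open import Relation.Nullary using (¬_; yes; no)
open import Relation.Nullary.Decidable using (⌊_⌋)
open import Relation.Binary.PropositionalEquality using (_≡_; refl; sym)
open import Function.Definitions using (Injective)

record Graph (n : ℕ) : Set where
  field
    Adj    : Fin n → Fin n → Bool
    symm   : ∀ u v → Adj u v ≡ Adj v u
    irrefl : ∀ v → Adj v v ≡ false
open Graph public

deg : {n : ℕ} → Graph n → Fin n → ℕ
deg {n} G v = sum (map (λ u → if Adj G v u then 1 else 0) (allFin n))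

Regular : ℕ → {n : ℕ} → Graph n → Set
Regular d {n} G = ∀ v → deg G v ≡ d

-- An embedding of G into H (witness that H has a subgraph isomorphic to G):
-- an injective vertex map sending edges to edges.
record Embedding {k m : ℕ} (G : Graph k) (H : Graph m) : Set where
  field
    f      : Fin k → Fin m
    inj    : Injective _≡_ _≡_ f
    edges  : ∀ u v → Adj G u v ≡ true → Adj H (f u) (f v) ≡ true
open Embedding public

-- Member of ℛ = the collection of all d-regular graphs (with at least one vertex).
-- "H contains a member of ℛ all of whose vertices lie in the vertex set P":
-- equivalently the subgraph of H induced by P has a subgraph isomorphic to a
-- member of ℛ.
ContainsRegularIn : ℕ → {m : ℕ} → Graph m → (Fin m → Set) → Set
ContainsRegularIn d {m} H P =
  Σ ℕ λ k → Σ (Graph (suc k)) λ G → Regular d G ×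
    Σ (Embedding G H) λ e → ∀ v → P (f e v)

RegFree : ℕ → {m : ℕ} → Graph m → Set
RegFree d H = ¬ ContainsRegularIn d H (λ _ → Data.Unit.⊤)
  where import Data.Unit

IsRegFreeColoring : ℕ → {m : ℕ} → Graph m → (k : ℕ) → (Fin m → Fin k) → Set
IsRegFreeColoring d H k c = ∀ i → ¬ ContainsRegularIn d H (λ v → c v ≡ i)

Colorable : ℕ → {m : ℕ} → Graph m → ℕ → Set
Colorable d {m} H k = Σ (Fin m → Fin k) λ c → IsRegFreeColoring d H k c

IsChi : ℕ → {m : ℕ} → Graph m → ℕ → Set
IsChi d H k = Colorable d H k × (∀ j → Colorable d H j → k ≤ j)

-- Join H ⊕ K_n on vertex set Fin (m + n): first m vertices are H, last n are K_n.
private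
  joinAdj : {m n : ℕ} → Graph m → Fin (m + n) → Fin (m + n) → Bool
  joinAdj {m} H x y with splitAt m x | splitAt m y
  ... | inj₁ a | inj₁ b = Adj H a b
  ... | inj₁ a | inj₂ b = true
  ... | inj₂ a | inj₁ b = true
  ... | inj₂ a | inj₂ b = not ⌊ a ≟ b ⌋

  eqb-sym : {n : ℕ} (a b : Fin n) → ⌊ a ≟ b ⌋ ≡ ⌊ b ≟ a ⌋
  eqb-sym a b with a ≟ b | b ≟ a
  ... | yes _ | yes _ = refl
  ... | no _ | no _ = refl
  ... | yes p | no q = Data.Empty.⊥-elim (q (sym p))
    where import Data.Empty
  ... | no p | yes q = Data.Empty.⊥-elim (p (sym q))
    where import Data.Empty

  eqb-refl : {n : ℕ} (a : Fin n) → ⌊ a ≟ a ⌋ ≡ true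
  eqb-refl a with a ≟ a
  ... | yes _ = refl
  ... | no p = Data.Empty.⊥-elim (p refl)
    where import Data.Empty

  joinSym : {m n : ℕ} (H : Graph m) (x y : Fin (m + n)) → joinAdj {m} {n} H x y ≡ joinAdj H y x
  joinSym {m} H x y with splitAt m x | splitAt m y
  ... | inj₁ a | inj₁ b = symm H a b
  ... | inj₁ a | inj₂ b = refl
  ... | inj₂ a | inj₁ b = refl
  ... | inj₂ a | inj₂ b rewrite eqb-sym a b = refl

  joinIrr : {m n : ℕ} (H : Graph m) (x : Fin (m + n)) → joinAdj {m} {n} H x x ≡ false
  joinIrr {m} H x with splitAt m x
  ... | inj₁ a = irrefl H a
  ... | inj₂ a rewrite eqb-refl a = refl

_⊕K_ : {m : ℕ} → Graph m → (n : ℕ) → Graph (m + n)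
H ⊕K n = record { Adj = joinAdj H ; symm = joinSym H ; irrefl = joinIrr H }

{-# OPTIONS --safe #-}
module Submission where

-- No colour class of an ℛ-free colouring of H ⊕ K_n contains K_{d+1}, which is d-regular.
-- Restricting the colouring to H and discarding unused colours shows that at least χ_ℛ(H)
-- colours meet H. A class meeting H contains at most d − 1 vertices of K_n, since these
-- together with a vertex of H span a clique; every other class contains at most d of them.
-- Summing these capacities over the b colours gives n ≤ d b − χ_ℛ(H).

open import Defs
open import Data.Bool using (Bool; true; false; not; if_then_else_)
open import Data.Empty using (⊥-elim)
open import Data.Fin using (Fin; zero; suc; _↑ˡ_; _↑ʳ_; splitAt; inject≤; _≟_)
open import Data.Fin.Properties
  using (any?; suc-injective; ↑ˡ-injective; ↑ʳ-injective; splitAt-↑ˡ; splitAt-↑ʳ; inject≤-injective)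
open import Data.List using (map; allFin; tabulate)
open import Data.List.Properties using (map-tabulate)
open import Data.Nat using (ℕ; zero; suc; _+_; _*_; _∸_; _≤_; z≤n; s≤s; _≤?_)
open import Data.Nat.ListAction using () renaming (sum to sumₗ)
open import Data.Nat.Properties
  using (+-0-commutativeMonoid; +-comm; *-comm; *-zeroʳ; *-identityʳ; +-cancelʳ-≡; +-mono-≤; ≤-trans; ≰⇒>;
         ∸-monoˡ-≤; m+[n∸m]≡n; m∸n+n≡m; module ≤-Reasoning)
open import Algebra.Properties.CommutativeMonoid.Sum +-0-commutativeMonoid
  using (sum-syntax; ∑-distrib-+; sum-cong-≗)
open import Data.Product using (∃; _,_)
open import Data.Vec.Functional using (_∷_)
open import Function using (_∘_)
open import Function.Definitions using (Injective)
open import Relation.Nullary using (does; yes; no)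
open import Relation.Nullary.Decidable using (isYes≗does)
open import Relation.Unary using (Pred; Decidable)
open import Relation.Binary.PropositionalEquality

𝟙 : Bool → ℕ
𝟙 b = if b then 1 else 0

𝟙≤1 : ∀ b → 𝟙 b ≤ 1
𝟙≤1 true  = s≤s z≤n
𝟙≤1 false = z≤n

𝟙-not-+-𝟙 : ∀ b → 𝟙 (not b) + 𝟙 b ≡ 1
𝟙-not-+-𝟙 true  = refl
𝟙-not-+-𝟙 false = refl

∑-const : ∀ b x → ∑[ i < b ] x ≡ b * x
∑-const zero    x = refl
∑-const (suc b) x = cong (x +_) (∑-const b x)

∑-𝟙-≟ : ∀ {b} (j : Fin b) → ∑[ i < b ] 𝟙 (does (j ≟ i)) ≡ 1
∑-𝟙-≟ {suc b} zero    = cong suc (trans (∑-const b 0) (*-zeroʳ b))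
∑-𝟙-≟ {suc b} (suc j) = ∑-𝟙-≟ j

sumₗ-map-allFin : ∀ n (g : Fin n → ℕ) → sumₗ (map g (allFin n)) ≡ ∑[ i < n ] g i
sumₗ-map-allFin n g = trans (cong sumₗ (map-tabulate (λ i → i) g)) (sumₗ-tabulate n g)
  where
  sumₗ-tabulate : ∀ n (g : Fin n → ℕ) → sumₗ (tabulate g) ≡ ∑[ i < n ] g i
  sumₗ-tabulate zero    g = refl
  sumₗ-tabulate (suc n) g = cong (g zero +_) (sumₗ-tabulate n (g ∘ suc))

count : ∀ {k p} {P : Pred (Fin k) p} → Decidable P → ℕ
count {k} P? = ∑[ i < k ] 𝟙 (does (P? i))

rank : ∀ {k p} {P : Pred (Fin k) p} (P? : Decidable P) {i} → P i → Fin (count P?)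
rank {suc k} P? {zero} p with P? zero
... | yes _  = zero
... | no ¬p = ⊥-elim (¬p p)
rank {suc k} P? {suc i} p = 𝟙 (does (P? zero)) ↑ʳ rank (P? ∘ suc) p

rank-injective : ∀ {k p} {P : Pred (Fin k) p} (P? : Decidable P) {i j} (p : P i) (q : P j) →
                 rank P? p ≡ rank P? q → i ≡ j
rank-injective {suc k} P? {zero}  {zero}  p q eq = refl
rank-injective {suc k} P? {zero}  {suc j} p q eq with P? zero
rank-injective {suc k} P? {zero}  {suc j} p q () | yes _
... | no ¬p = ⊥-elim (¬p p)
rank-injective {suc k} P? {suc i} {zero}  p q eq with P? zero
rank-injective {suc k} P? {suc i} {zero}  p q () | yes _
... | no ¬q = ⊥-elim (¬q q)
rank-injective {suc k} P? {suc i} {suc j} p q eq =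
  cong suc (rank-injective (P? ∘ suc) p q (↑ʳ-injective (𝟙 (does (P? zero))) _ _ eq))

∷-injective : ∀ {a k} {A : Set a} {x : A} {f : Fin k → A} →
              (∀ i → x ≢ f i) → Injective _≡_ _≡_ f → Injective _≡_ _≡_ (x ∷ f)
∷-injective x∉f inj {zero}  {zero}  _  = refl
∷-injective x∉f inj {zero}  {suc j} eq = ⊥-elim (x∉f j eq)
∷-injective x∉f inj {suc i} {zero}  eq = ⊥-elim (x∉f i (sym eq))
∷-injective x∉f inj {suc i} {suc j} eq = cong suc (inj eq)

deg-∑ : ∀ {n} (G : Graph n) v → deg G v ≡ ∑[ u < n ] 𝟙 (Adj G v u)
deg-∑ {n} G v = sumₗ-map-allFin n (λ u → 𝟙 (Adj G v u))

-- K_k is the join of the graph on no vertices with K_k, which reuses the join's symmetry proofs.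
complete : ∀ k → Graph k
complete k = empty ⊕K k
  where
  empty : Graph 0
  empty = record { Adj = λ () ; symm = λ () ; irrefl = λ () }

complete-adj⇒≢ : ∀ {k} {u v : Fin k} → Adj (complete k) u v ≡ true → u ≢ v
complete-adj⇒≢ {k} {u} adj refl with () ← trans (sym adj) (irrefl (complete k) u)

≢⇒complete-adj : ∀ {k} {u v : Fin k} → u ≢ v → Adj (complete k) u v ≡ true
≢⇒complete-adj {u = u} {v} u≢v with u ≟ v
... | yes u≡v = ⊥-elim (u≢v u≡v)
... | no  _   = refl

complete-regular : ∀ d → Regular d (complete (suc d))
complete-regular d v = +-cancelʳ-≡ 1 _ _ (begin
  deg (complete (suc d)) v + 1
    ≡⟨ cong (_+ 1) (deg-∑ (complete (suc d)) v) ⟩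
  ∑[ u < suc d ] 𝟙 (Adj (complete (suc d)) v u) + 1
    ≡⟨ cong₂ _+_ (sum-cong-≗ (λ u → cong (𝟙 ∘ not) (isYes≗does (v ≟ u)))) (sym (∑-𝟙-≟ v)) ⟩
  ∑[ u < suc d ] 𝟙 (not (does (v ≟ u))) + ∑[ u < suc d ] 𝟙 (does (v ≟ u))
    ≡⟨ ∑-distrib-+ (λ u → 𝟙 (not (does (v ≟ u)))) (λ u → 𝟙 (does (v ≟ u))) ⟨
  ∑[ u < suc d ] (𝟙 (not (does (v ≟ u))) + 𝟙 (does (v ≟ u)))
    ≡⟨ sum-cong-≗ (λ u → 𝟙-not-+-𝟙 (does (v ≟ u))) ⟩
  ∑[ u < suc d ] 1
    ≡⟨ ∑-const (suc d) 1 ⟩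
  suc d * 1
    ≡⟨ trans (*-identityʳ (suc d)) (+-comm 1 d) ⟩
  d + 1 ∎)
  where open ≡-Reasoning

IsClique : ∀ {k N} → Graph N → (Fin k → Fin N) → Set
IsClique J e = ∀ x y → x ≢ y → Adj J (e x) (e y) ≡ true

∷-isClique : ∀ {k N} {J : Graph N} {v : Fin N} {e : Fin k → Fin N} →
             (∀ x → Adj J v (e x) ≡ true) → IsClique J e → IsClique J (v ∷ e)
∷-isClique v~e clique zero    zero    x≢y = ⊥-elim (x≢y refl)
∷-isClique v~e clique zero    (suc y) _   = v~e y
∷-isClique {J = J} {v} {e} v~e clique (suc x) zero _ = trans (symm J (e x) v) (v~e x)
∷-isClique v~e clique (suc x) (suc y) x≢y = clique x y (x≢y ∘ cong suc)

clique⇒containsRegular : ∀ {d N} {J : Graph N} {P : Fin N → Set} (e : Fin (suc d) → Fin N) →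
  Injective _≡_ _≡_ e → IsClique J e → (∀ x → P (e x)) → ContainsRegularIn d J P
clique⇒containsRegular {d} e inj clique e∈P =
  d , complete (suc d) , complete-regular d ,
  record { f = e ; inj = inj ; edges = λ u v adj → clique u v (complete-adj⇒≢ adj) } , e∈P

isClique-∘ : ∀ {k l N} {J : Graph N} {e : Fin l → Fin N} {g : Fin k → Fin l} →
             IsClique J e → Injective _≡_ _≡_ g → IsClique J (e ∘ g)
isClique-∘ clique g-inj x y x≢y = clique _ _ (x≢y ∘ g-inj)

monochromatic-clique-≤ : ∀ {d N k l} {J : Graph N} (c : Fin N → Fin k) → IsRegFreeColoring d J k c →
  ∀ {i} (e : Fin l → Fin N) → Injective _≡_ _≡_ e → IsClique J e → (∀ x → c (e x) ≡ i) → l ≤ d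
monochromatic-clique-≤ {d} {l = l} {J = J} c valid {i} e inj clique mono with l ≤? d
... | yes l≤d = l≤d
... | no  l≰d = ⊥-elim (valid i (clique⇒containsRegular {P = λ v → c v ≡ i} (e ∘ embed)
                  (embed-inj ∘ inj) (isClique-∘ {J = J} clique embed-inj) (mono ∘ embed)))
  where
  d<l = ≰⇒> l≰d
  embed : Fin (suc d) → Fin l
  embed x = inject≤ x d<l
  embed-inj : Injective _≡_ _≡_ embed
  embed-inj = inject≤-injective d<l d<l _ _

_∘ᴱ_ : ∀ {k l m} {G : Graph k} {H : Graph l} {J : Graph m} → Embedding H J → Embedding G H → Embedding G J
g ∘ᴱ h = record
  { f     = f g ∘ f h
  ; inj   = inj h ∘ inj g
  ; edges = λ u v adj → edges g (f h u) (f h v) (edges h u v adj)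
  }

restrict-isRegFreeColoring : ∀ {d k l m} {H : Graph l} {J : Graph m} (c : Fin m → Fin k) →
  (g : Embedding H J) → IsRegFreeColoring d J k c → IsRegFreeColoring d H k (c ∘ f g)
restrict-isRegFreeColoring c g valid i (k , G , reg , e , mono) = valid i (k , G , reg , g ∘ᴱ e , mono)

refine-isRegFreeColoring : ∀ {d m k k′} {H : Graph m} (c : Fin m → Fin k) (c′ : Fin m → Fin k′) →
  (∀ v w → c′ v ≡ c′ w → c v ≡ c w) → IsRegFreeColoring d H k c → IsRegFreeColoring d H k′ c′
refine-isRegFreeColoring c c′ refines valid _ (k , G , reg , e , mono) =
  valid (c (f e zero)) (k , G , reg , e , λ x → refines _ _ (trans (mono x) (sym (mono zero))))

inImage? : ∀ {m b} (c : Fin m → Fin b) → Decidable (λ i → ∃ λ v → c v ≡ i)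
inImage? c i = any? (λ v → c v ≟ i)

colorable-count-image : ∀ {d m b} {H : Graph m} (c : Fin m → Fin b) →
  IsRegFreeColoring d H b c → Colorable d H (count (inImage? c))
colorable-count-image c valid =
  (λ v → rank (inImage? c) (v , refl)) ,
  refine-isRegFreeColoring c _ (λ v w → rank-injective (inImage? c) (v , refl) (w , refl)) valid

pigeonhole-capacities : ∀ {n b} (c : Fin n → Fin b) (cap : Fin b → ℕ) →
  (∀ i {k} (e : Fin k → Fin n) → Injective _≡_ _≡_ e → (∀ x → c (e x) ≡ i) → k ≤ cap i) →
  n ≤ ∑[ i < b ] cap i
pigeonhole-capacities {zero}  c cap bound = z≤n
pigeonhole-capacities {suc n} {b} c cap bound = begin
  suc n                                 ≤⟨ s≤s (pigeonhole-capacities (c ∘ suc) cap′ bound′) ⟩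
  suc (∑[ i < b ] cap′ i)               ≡⟨ +-comm 1 _ ⟩
  ∑[ i < b ] cap′ i + 1                 ≡⟨ cong (∑[ i < b ] cap′ i +_) (∑-𝟙-≟ (c zero)) ⟨
  ∑[ i < b ] cap′ i + ∑[ i < b ] δ i    ≡⟨ ∑-distrib-+ cap′ δ ⟨
  ∑[ i < b ] (cap′ i + δ i)             ≡⟨ sum-cong-≗ (λ i → m∸n+n≡m (δ≤cap i)) ⟩
  ∑[ i < b ] cap i                      ∎
  where
  open ≤-Reasoning
  δ : Fin b → ℕ
  δ i = 𝟙 (does (c zero ≟ i))
  cap′ : Fin b → ℕ
  cap′ i = cap i ∸ δ i
  -- vertex zero uses up one unit of the capacity of its colour c zero
  δ≤cap : ∀ i → 𝟙 (does (c zero ≟ i)) ≤ cap i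
  δ≤cap i with c zero ≟ i
  ... | no  _    = z≤n
  ... | yes refl = bound (c zero) (λ _ → zero) (λ { {zero} {zero} _ → refl }) (λ { zero → refl })
  bound′ : ∀ i {k} (e : Fin k → Fin n) → Injective _≡_ _≡_ e → (∀ x → c (suc (e x)) ≡ i) →
           k ≤ cap i ∸ 𝟙 (does (c zero ≟ i))
  bound′ i e inj mono with c zero ≟ i
  ... | no  _    = bound i (suc ∘ e) (inj ∘ suc-injective) mono
  ... | yes refl = ∸-monoˡ-≤ 1 (bound (c zero) (zero ∷ suc ∘ e)
                     (∷-injective (λ _ ()) (inj ∘ suc-injective)) (λ { zero → refl ; (suc x) → mono x }))

module _ {m : ℕ} (H : Graph m) (n : ℕ) where

  ↑ˡ-adj-↑ˡ : ∀ v w → Adj (H ⊕K n) (v ↑ˡ n) (w ↑ˡ n) ≡ Adj H v w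
  ↑ˡ-adj-↑ˡ v w rewrite splitAt-↑ˡ m v n | splitAt-↑ˡ m w n = refl

  ↑ˡ-adj-↑ʳ : ∀ v x → Adj (H ⊕K n) (v ↑ˡ n) (m ↑ʳ x) ≡ true
  ↑ˡ-adj-↑ʳ v x rewrite splitAt-↑ˡ m v n | splitAt-↑ʳ m n x = refl

  ↑ʳ-adj-↑ʳ : ∀ x y → Adj (H ⊕K n) (m ↑ʳ x) (m ↑ʳ y) ≡ Adj (complete n) x y
  ↑ʳ-adj-↑ʳ x y rewrite splitAt-↑ʳ m n x | splitAt-↑ʳ m n y = refl

  ↑ˡ≢↑ʳ : ∀ v x → v ↑ˡ n ≢ m ↑ʳ x
  ↑ˡ≢↑ʳ v x eq with () ← trans (sym (splitAt-↑ˡ m v n)) (trans (cong (splitAt m) eq) (splitAt-↑ʳ m n x))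

  ↑ˡ-embedding : Embedding H (H ⊕K n)
  ↑ˡ-embedding = record
    { f     = _↑ˡ n
    ; inj   = ↑ˡ-injective n _ _
    ; edges = λ v w adj → trans (↑ˡ-adj-↑ˡ v w) adj
    }

  ↑ʳ-isClique : ∀ {k} {e : Fin k → Fin n} → Injective _≡_ _≡_ e → IsClique (H ⊕K n) ((m ↑ʳ_) ∘ e)
  ↑ʳ-isClique inj x y x≢y = trans (↑ʳ-adj-↑ʳ _ _) (≢⇒complete-adj (x≢y ∘ inj))

  cone-isClique : ∀ {k} (v : Fin m) {e : Fin k → Fin n} → Injective _≡_ _≡_ e →
                  IsClique (H ⊕K n) ((v ↑ˡ n) ∷ (m ↑ʳ_) ∘ e)
  cone-isClique v inj = ∷-isClique {J = H ⊕K n} (λ x → ↑ˡ-adj-↑ʳ v _) (↑ʳ-isClique inj)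

  cone-injective : ∀ {k} (v : Fin m) {e : Fin k → Fin n} → Injective _≡_ _≡_ e →
                   Injective _≡_ _≡_ ((v ↑ˡ n) ∷ (m ↑ʳ_) ∘ e)
  cone-injective v inj = ∷-injective (λ x → ↑ˡ≢↑ʳ v _) (inj ∘ ↑ʳ-injective m _ _)

  join-fibre-bound : ∀ {d b} (c : Fin (m + n) → Fin b) → IsRegFreeColoring d (H ⊕K n) b c →
    ∀ i {k} (e : Fin k → Fin n) → Injective _≡_ _≡_ e → (∀ x → c (m ↑ʳ e x) ≡ i) →
    k ≤ d ∸ 𝟙 (does (inImage? (c ∘ (_↑ˡ n)) i))
  join-fibre-bound c valid i e inj mono with inImage? (c ∘ (_↑ˡ n)) i
  ... | no  _        = monochromatic-clique-≤ c valid ((m ↑ʳ_) ∘ e)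
                         (inj ∘ ↑ʳ-injective m _ _) (↑ʳ-isClique inj) mono
  ... | yes (v , cv) = ∸-monoˡ-≤ 1 (monochromatic-clique-≤ c valid ((v ↑ˡ n) ∷ (m ↑ʳ_) ∘ e)
                         (cone-injective v inj) (cone-isClique v inj) λ { zero → cv ; (suc x) → mono x })

lemma5 : (d : ℕ) → 1 ≤ d → (n : ℕ) → 1 ≤ n → {m : ℕ} → (H : Graph m) →
    (a b : ℕ) → IsChi d H a → IsChi d (H ⊕K n) b → a + n ≤ d * b
-- The bound also holds for n = 0.
lemma5 d 1≤d n _ {m} H a b (_ , minimal) ((c , valid) , _) = begin
  a + n
    ≤⟨ +-mono-≤ (minimal _ (colorable-count-image cH (restrict-isRegFreeColoring c (↑ˡ-embedding H n) valid)))
                (pigeonhole-capacities (c ∘ (m ↑ʳ_)) cap (join-fibre-bound H n c valid)) ⟩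
  ∑[ i < b ] used i + ∑[ i < b ] cap i
    ≡⟨ ∑-distrib-+ used cap ⟨
  ∑[ i < b ] (used i + cap i)
    ≡⟨ sum-cong-≗ (λ i → m+[n∸m]≡n (≤-trans (𝟙≤1 (does (inImage? cH i))) 1≤d)) ⟩
  ∑[ i < b ] d
    ≡⟨ trans (∑-const b d) (*-comm b d) ⟩
  d * b ∎
  where
  open ≤-Reasoning
  cH : Fin m → Fin b
  cH = c ∘ (_↑ˡ n)
  used : Fin b → ℕ
  used i = 𝟙 (does (inImage? cH i))
  cap : Fin b → ℕ
  cap i = d ∸ used i
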